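{- Let $k\ge 2$ and let $f^k_{k,n}$ and $l^k_{k,n}$ be the $k$-th sequences of the $k$ sequences of generalized order-$k$ Fibonacci numbers and Lucas numbers, respectively, as defined in the context. Then for every integer $n\ge 0$, $$l^k_{k,n}=\sum_{j=1}^{k} j\, f^k_{k,n+1-j}.$$
   Context: $k$ sequences of generalized order-$k$ Fibonacci numbers: for $1\le i\le k$, $f^i_{k,n}=1$ if $1-k\le n\le 0$ and $i=1-n$, $f^i_{k,n}=0$ if $1-k\le n\le 0$ and $i\neq 1-n$, and $f^i_{k,n}=\sum_{j=1}^k f^i_{k,n-j}$ for $n\ge 1$. $k$ sequences of generalized order-$k$ Lucas numbers: for $1\le i\le k$ and $1-k\le n\le 0$, $l^i_{k,n}=-i$ if $i-n<k$, $l^i_{k,n}=i-2n$ if $i-n=k$, $l^i_{k,n}=k-i-1$ if $i-n>k$; and $l^i_{k,n}=\sum_{j=1}^k l^i_{k,n-j}$ for $n\ge 1$. -}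

module Defs where

open import Data.Nat as ℕ using (ℕ; zero; suc; _∸_)
open import Data.Integer as ℤ using (ℤ; +_; -_; _+_; _-_; _*_; _<?_; _≟_; ∣_∣)
open import Data.List using (List; []; _∷_; take)
open import Relation.Nullary.Decidable using (does)
open import Data.Bool using (if_then_else_)

sumℤ : List ℤ → ℤ
sumℤ [] = + 0
sumℤ (x ∷ xs) = x + sumℤ xs

Σ₁ : ℕ → (ℕ → ℤ) → ℤ
Σ₁ zero    g = + 0
Σ₁ (suc k) g = Σ₁ k g + g (suc k)

-- Order-k linear recurrence with initial values given on indices n = 1-k,…,0.
-- Internally index m : ℕ stands for n = m - (k - 1), i.e. m = n + k - 1.
-- hist k init m = [a_m, a_{m-1}, …, a_0]  (internal indices)
hist : (k : ℕ) → (ℤ → ℤ) → ℕ → List ℤ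
hist k init zero = init (+ 0 - + (k ∸ 1)) ∷ []
hist k init (suc m) with does (suc m ℕ.<? k)
... | Data.Bool.true  = init (+ suc m - + (k ∸ 1)) ∷ hist k init m
... | Data.Bool.false = sumℤ (take k (hist k init m)) ∷ hist k init m

headℤ : List ℤ → ℤ
headℤ [] = + 0
headℤ (x ∷ _) = x

-- a_n for integer n ≥ 1-k, where a_n = init n for 1-k ≤ n ≤ 0 and
-- a_n = Σ_{j=1}^k a_{n-j} for n ≥ 1.  (Junk value for n < 1-k.)
recSeq : (k : ℕ) → (ℤ → ℤ) → ℤ → ℤ
recSeq k init n = headℤ (hist k init ∣ n + + (k ∸ 1) ∣)

fibInit : ℕ → ℤ → ℤ
fibInit i n = if does (+ i ≟ + 1 - n) then + 1 else + 0

lucInit : ℕ → ℕ → ℤ → ℤ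
lucInit k i n =
  if does (+ i - n <? + k) then - + i
  else if does (+ i - n ≟ + k) then + i - (+ 2 * n)
  else + k - + i - + 1

fib : (k i : ℕ) → ℤ → ℤ
fib k i = recSeq k (fibInit i)

luc : (k i : ℕ) → ℤ → ℤ
luc k i = recSeq k (lucInit k i)

module Submission where

-- Work in the internal indexing of Defs, where position m stands for
-- n = m - (k - 1); write c = k - 1, so F m = f^k_{k,m-c} and
-- L m = l^k_{k,m-c}.  The right-hand side refers to f at indices below the
-- initial window, so extend F backwards: Φ is F preceded by the value
-- f^k_{k,-k} = -1 and by zeros.  The extension still satisfies the order-k
-- recurrence, hence so does every weighted combination of shifted copies
-- of it, in particular Ψ t = Σ_{j=1}^k j · Φ(t + k - j).  Ψ agrees with L
-- on the initial window (both are -1 below c and k at c), so L = Ψ by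
-- uniqueness of solutions of the recurrence, which is the theorem.

open import Defs
open import Data.Nat using (ℕ; _≥_)
open import Data.Integer using (ℤ; +_; _+_; _-_; _*_)
open import Relation.Binary.PropositionalEquality using (_≡_)
open import Data.Nat as ℕ using (zero; suc; _∸_; _≤_; _<_; z≤n; s≤s)
import Data.Nat.Properties as ℕP
open import Data.Nat.Induction using (<-rec)
open import Data.Integer as ℤ using (-_)
import Data.Integer.Properties as ℤP
open import Data.Integer.Tactic.RingSolver using (solve-∀)
open import Data.List using (_∷_; take)
open import Data.Bool using (true; false; T; if_then_else_)
open import Data.Unit using (tt)
open import Data.Empty using (⊥-elim)
open import Relation.Nullary using (Dec; ¬_; yes; no)
open import Relation.Nullary.Decidable using (does; dec-true; dec-false)
open import Relation.Binary.PropositionalEquality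
  using (refl; sym; trans; cong; cong₂; subst; subst₂; module ≡-Reasoning)

open ≡-Reasoning

Σ₁-cong : ∀ k {g h : ℕ → ℤ} → (∀ i → 1 ≤ i → i ≤ k → g i ≡ h i) →
          Σ₁ k g ≡ Σ₁ k h
Σ₁-cong zero    e = refl
Σ₁-cong (suc k) e =
  cong₂ _+_ (Σ₁-cong k (λ i p q → e i p (ℕP.m≤n⇒m≤1+n q)))
            (e (suc k) (s≤s z≤n) ℕP.≤-refl)

Σ₁-zero : ∀ k {g : ℕ → ℤ} → (∀ i → 1 ≤ i → i ≤ k → g i ≡ + 0) → Σ₁ k g ≡ + 0
Σ₁-zero zero    z = refl
Σ₁-zero (suc k) z =
  cong₂ _+_ (Σ₁-zero k (λ i p q → z i p (ℕP.m≤n⇒m≤1+n q)))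
            (z (suc k) (s≤s z≤n) ℕP.≤-refl)

Σ₁-first : ∀ k (g : ℕ → ℤ) → Σ₁ (suc k) g ≡ g 1 + Σ₁ k (λ i → g (suc i))
Σ₁-first zero    g = ℤP.+-comm (+ 0) (g 1)
Σ₁-first (suc k) g = begin
  Σ₁ (suc k) g + g (suc (suc k))                    ≡⟨ cong (_+ g (suc (suc k))) (Σ₁-first k g) ⟩
  (g 1 + Σ₁ k (λ i → g (suc i))) + g (suc (suc k))  ≡⟨ ℤP.+-assoc (g 1) _ _ ⟩
  g 1 + Σ₁ (suc k) (λ i → g (suc i))                ∎

Σ₁-+ : ∀ k (g h : ℕ → ℤ) → Σ₁ k (λ i → g i + h i) ≡ Σ₁ k g + Σ₁ k h
Σ₁-+ zero    g h = refl
Σ₁-+ (suc k) g h = begin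
  Σ₁ k (λ i → g i + h i) + (g (suc k) + h (suc k))  ≡⟨ cong (_+ (g (suc k) + h (suc k))) (Σ₁-+ k g h) ⟩
  (Σ₁ k g + Σ₁ k h) + (g (suc k) + h (suc k))       ≡⟨ interchange (Σ₁ k g) (Σ₁ k h) (g (suc k)) (h (suc k)) ⟩
  (Σ₁ k g + g (suc k)) + (Σ₁ k h + h (suc k))       ∎
  where
  interchange : ∀ (a b x y : ℤ) → (a + b) + (x + y) ≡ (a + x) + (b + y)
  interchange = solve-∀

Σ₁-*ˡ : ∀ k (w : ℤ) (g : ℕ → ℤ) → w * Σ₁ k g ≡ Σ₁ k (λ i → w * g i)
Σ₁-*ˡ zero    w g = ℤP.*-zeroʳ w
Σ₁-*ˡ (suc k) w g =
  trans (ℤP.*-distribˡ-+ w (Σ₁ k g) (g (suc k)))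
        (cong (_+ w * g (suc k)) (Σ₁-*ˡ k w g))

Σ₁-swap : ∀ a b (h : ℕ → ℕ → ℤ) →
          Σ₁ a (λ i → Σ₁ b (h i)) ≡ Σ₁ b (λ j → Σ₁ a (λ i → h i j))
Σ₁-swap zero    b h = sym (Σ₁-zero b (λ _ _ _ → refl))
Σ₁-swap (suc a) b h =
  trans (cong (_+ Σ₁ b (h (suc a))) (Σ₁-swap a b h))
        (sym (Σ₁-+ b (λ j → Σ₁ a (λ i → h i j)) (h (suc a))))

Σ₁-last : ∀ k {g : ℕ → ℤ} → (∀ i → 1 ≤ i → i ≤ k → g i ≡ + 0) →
          Σ₁ (suc k) g ≡ g (suc k)
Σ₁-last k {g} z = trans (cong (_+ g (suc k)) (Σ₁-zero k z)) (ℤP.+-identityˡ (g (suc k)))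

Σ₁-two : ∀ k a {g : ℕ → ℤ} → 1 ≤ a → a < k →
         (∀ i → 1 ≤ i → i < a → g i ≡ + 0) →
         (∀ i → suc a < i → i ≤ k → g i ≡ + 0) →
         Σ₁ k g ≡ g a + g (suc a)
Σ₁-two (suc k) (suc a) {g} _ (s≤s a<k) lo hi with suc a ℕ.≟ k
... | yes refl = cong (_+ g (suc (suc a))) (Σ₁-last a (λ i p q → lo i p (s≤s q)))
... | no  a≢k  = begin
  Σ₁ k g + g (suc k)  ≡⟨ cong (λ z → Σ₁ k g + z) (hi (suc k) (s≤s a+1<k) ℕP.≤-refl) ⟩
  Σ₁ k g + + 0        ≡⟨ ℤP.+-identityʳ _ ⟩
  Σ₁ k g              ≡⟨ Σ₁-two k (suc a) (s≤s z≤n) a+1<k lo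
                           (λ i p q → hi i p (ℕP.m≤n⇒m≤1+n q)) ⟩
  g (suc a) + g (suc (suc a)) ∎
  where a+1<k = ℕP.≤∧≢⇒< a<k a≢k

term : ℕ → (ℤ → ℤ) → ℕ → ℤ
term k init m = headℤ (hist k init m)

hist-suc : ∀ k init m → hist k init (suc m) ≡ term k init (suc m) ∷ hist k init m
hist-suc k init m with does (suc m ℕ.<? k)
... | true  = refl
... | false = refl

sum-take-hist : ∀ k init j m → j ≤ suc m →
  sumℤ (take j (hist k init m)) ≡ Σ₁ j (λ i → term k init (suc m ∸ i))
sum-take-hist k init zero          m       _       = refl
sum-take-hist k init (suc zero)    zero    _       = ℤP.+-comm (term k init 0) (+ 0)
sum-take-hist k init (suc (suc j)) zero    (s≤s ())
sum-take-hist k init (suc j)       (suc m) (s≤s j≤m) = begin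
  sumℤ (take (suc j) (hist k init (suc m)))
    ≡⟨ cong (λ l → sumℤ (take (suc j) l)) (hist-suc k init m) ⟩
  term k init (suc m) + sumℤ (take j (hist k init m))
    ≡⟨ cong (λ z → term k init (suc m) + z) (sum-take-hist k init j m j≤m) ⟩
  term k init (suc m) + Σ₁ j (λ i → term k init (suc m ∸ i))
    ≡⟨ sym (Σ₁-first j (λ i → term k init (suc (suc m) ∸ i))) ⟩
  Σ₁ (suc j) (λ i → term k init (suc (suc m) ∸ i)) ∎

term-init : ∀ k init m → m < k → term k init m ≡ init (+ m - + (k ∸ 1))
term-init k init zero    _   = refl
term-init k init (suc m) m<k with suc m ℕ.<ᵇ k in eq
... | true  = refl
... | false = ⊥-elim (subst T eq (ℕP.<⇒<ᵇ m<k))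

Recurrent : ℕ → (ℕ → ℤ) → Set
Recurrent k X = ∀ m → k ≤ m → X m ≡ Σ₁ k (λ i → X (m ∸ i))

term-recurrent : ∀ k init → 1 ≤ k → Recurrent k (term k init)
term-recurrent (suc k) init _ zero    ()
term-recurrent k       init _ (suc m) k≤m with suc m ℕ.<ᵇ k in eq
... | true  = ⊥-elim (ℕP.<⇒≱ (ℕP.<ᵇ⇒< (suc m) k (subst T (sym eq) tt)) k≤m)
... | false = sum-take-hist k init k m k≤m

recurrent-unique : ∀ k {X Y : ℕ → ℤ} → Recurrent k X → Recurrent k Y →
  (∀ m → m < k → X m ≡ Y m) → ∀ m → X m ≡ Y m
recurrent-unique k {X} {Y} recX recY window = <-rec (λ m → X m ≡ Y m) step
  where
  step : ∀ m → (∀ {m′} → m′ < m → X m′ ≡ Y m′) → X m ≡ Y m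
  step m ih with m ℕ.<? k
  ... | yes m<k = window m m<k
  ... | no  m≮k = begin
    X m                      ≡⟨ recX m k≤m ⟩
    Σ₁ k (λ i → X (m ∸ i))   ≡⟨ Σ₁-cong k (λ i 1≤i i≤k →
                                  ih (ℕP.∸-monoʳ-< 1≤i (ℕP.≤-trans i≤k k≤m))) ⟩
    Σ₁ k (λ i → Y (m ∸ i))   ≡⟨ sym (recY m k≤m) ⟩
    Y m                      ∎
    where k≤m = ℕP.≮⇒≥ m≮k

shiftSum : ℕ → (ℕ → ℤ) → (ℕ → ℤ) → ℕ → ℤ
shiftSum a w X t = Σ₁ a (λ j → w j * X (t ℕ.+ a ∸ j))

-- The recurrence is linear and shift-invariant, so it passes to shiftSum.
shiftSum-recurrent : ∀ k a w X → Recurrent k X → Recurrent k (shiftSum a w X)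
shiftSum-recurrent k a w X recX t k≤t = begin
  Σ₁ a (λ j → w j * X (t ℕ.+ a ∸ j))
    ≡⟨ Σ₁-cong a (λ j _ j≤a → cong (w j *_) (recX (t ℕ.+ a ∸ j) (k≤shift j≤a))) ⟩
  Σ₁ a (λ j → w j * Σ₁ k (λ i → X (t ℕ.+ a ∸ j ∸ i)))
    ≡⟨ Σ₁-cong a (λ j _ _ → Σ₁-*ˡ k (w j) _) ⟩
  Σ₁ a (λ j → Σ₁ k (λ i → w j * X (t ℕ.+ a ∸ j ∸ i)))
    ≡⟨ Σ₁-swap a k (λ j i → w j * X (t ℕ.+ a ∸ j ∸ i)) ⟩
  Σ₁ k (λ i → Σ₁ a (λ j → w j * X (t ℕ.+ a ∸ j ∸ i)))
    ≡⟨ Σ₁-cong k (λ i _ i≤k → Σ₁-cong a (λ j _ j≤a →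
         cong (λ m → w j * X m) (reorder i≤k j≤a))) ⟩
  Σ₁ k (λ i → shiftSum a w X (t ∸ i)) ∎
  where
  k≤shift : ∀ {j} → j ≤ a → k ≤ t ℕ.+ a ∸ j
  k≤shift {j} j≤a = subst (k ≤_) (sym (ℕP.+-∸-assoc t j≤a))
                          (ℕP.≤-trans k≤t (ℕP.m≤m+n t (a ∸ j)))
  reorder : ∀ {i j} → i ≤ k → j ≤ a → t ℕ.+ a ∸ j ∸ i ≡ t ∸ i ℕ.+ a ∸ j
  reorder {i} {j} i≤k j≤a = begin
    t ℕ.+ a ∸ j ∸ i      ≡⟨ cong (_∸ i) (ℕP.+-∸-assoc t j≤a) ⟩
    t ℕ.+ (a ∸ j) ∸ i    ≡⟨ ℕP.+-∸-comm (a ∸ j) (ℕP.≤-trans i≤k k≤t) ⟩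
    t ∸ i ℕ.+ (a ∸ j)    ≡⟨ sym (ℕP.+-∸-assoc (t ∸ i) j≤a) ⟩
    t ∸ i ℕ.+ a ∸ j      ∎

recSeq-term : ∀ k init m → recSeq k init (+ m - + (k ∸ 1)) ≡ term k init m
recSeq-term k init m =
  cong (λ z → term k init ℤ.∣ z ∣) (minus-plus (+ m) (+ (k ∸ 1)))
  where
  minus-plus : ∀ (a b : ℤ) → a - b + b ≡ a
  minus-plus = solve-∀

pad : ℕ → ℤ → (ℕ → ℤ) → ℕ → ℤ
pad zero    x X zero    = x
pad zero    x X (suc t) = X t
pad (suc e) x X zero    = + 0
pad (suc e) x X (suc t) = pad e x X t

pad-below : ∀ e x X t → t < e → pad e x X t ≡ + 0
pad-below (suc e) x X zero    _         = refl
pad-below (suc e) x X (suc t) (s≤s t<e) = pad-below e x X t t<e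

pad-at : ∀ e x X → pad e x X e ≡ x
pad-at zero    x X = refl
pad-at (suc e) x X = pad-at e x X

pad-above : ∀ e x X s → pad e x X (suc e ℕ.+ s) ≡ X s
pad-above zero    x X s = refl
pad-above (suc e) x X s = pad-above e x X s

if-holds : ∀ {P A : Set} (p? : Dec P) {x y : A} → P → (if does p? then x else y) ≡ x
if-holds p? p = cong (λ b → if b then _ else _) (dec-true p? p)

if-fails : ∀ {P A : Set} (p? : Dec P) {x y : A} → ¬ P → (if does p? then x else y) ≡ y
if-fails p? ¬p = cong (λ b → if b then _ else _) (dec-false p? ¬p)

module Order (d : ℕ) where

  c k : ℕ
  c = suc d
  k = suc c

  F L : ℕ → ℤ
  F = term k (fibInit k)
  L = term k (lucInit k k)

  fib-index : ∀ m → m ≤ c → + 1 - (+ m - + c) ≡ + (k ∸ m)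
  fib-index m m≤c = begin
    + 1 - (+ m - + c)  ≡⟨ regroup (+ 1) (+ m) (+ c) ⟩
    + k - + m          ≡⟨ ℤP.m-n≡m⊖n k m ⟩
    k ℤ.⊖ m            ≡⟨ ℤP.⊖-≥ (ℕP.m≤n⇒m≤1+n m≤c) ⟩
    + (k ∸ m)          ∎
    where
    regroup : ∀ (a x y : ℤ) → a - (x - y) ≡ (a + y) - x
    regroup = solve-∀

  F-init : ∀ m → m < k → F m ≡ (if does (+ k ℤ.≟ + (k ∸ m)) then + 1 else + 0)
  F-init m m<k = trans (term-init k (fibInit k) m m<k)
    (cong (λ z → if does (+ k ℤ.≟ z) then + 1 else + 0) (fib-index m (ℕP.≤-pred m<k)))

  F-start : F 0 ≡ + 1
  F-start = trans (F-init 0 (s≤s z≤n)) (if-holds (+ k ℤ.≟ + k) refl)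

  F-zero : ∀ s → 1 ≤ s → s < k → F s ≡ + 0
  F-zero s 1≤s s<k = trans (F-init s s<k) (if-fails (+ k ℤ.≟ + (k ∸ s))
    (λ e → ℕP.<-irrefl (sym (ℤP.+-injective e)) (ℕP.∸-monoʳ-< 1≤s (ℕP.<⇒≤ s<k))))

  L-at : L c ≡ + k
  L-at = begin
    L c                        ≡⟨ term-init k (lucInit k k) c ℕP.≤-refl ⟩
    lucInit k k (+ c - + c)    ≡⟨ cong (lucInit k k) (ℤP.+-inverseʳ (+ c)) ⟩
    lucInit k k (+ 0)          ≡⟨ if-fails (+ k - + 0 ℤ.<? + k)
                                    (λ lt → ℤP.<-irrefl (ℤP.+-identityʳ (+ k)) lt) ⟩
    (if does (+ k - + 0 ℤ.≟ + k) then + k - + 0 else + k - + k - + 1)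
                               ≡⟨ if-holds (+ k - + 0 ℤ.≟ + k) (ℤP.+-identityʳ (+ k)) ⟩
    + k - + 0                  ≡⟨ ℤP.+-identityʳ (+ k) ⟩
    + k                        ∎

  L-below : ∀ t → t < c → L t ≡ - + 1
  L-below t t<c = begin
    L t                           ≡⟨ term-init k (lucInit k k) t (ℕP.m≤n⇒m≤1+n t<c) ⟩
    lucInit k k (+ t - + c)       ≡⟨ if-fails (+ k - (+ t - + c) ℤ.<? + k)
                                       (λ lt → ℕP.m+n≮m k v (ℤP.drop‿+<+ (subst (ℤ._< + k) shifted lt))) ⟩
    (if does (+ k - (+ t - + c) ℤ.≟ + k) then _ else + k - + k - + 1)
                                  ≡⟨ if-fails (+ k - (+ t - + c) ℤ.≟ + k)
                                       (λ e → ℕP.<-irrefl (sym (ℤP.+-injective (trans (sym shifted) e)))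
                                                          (ℕP.m<m+n k (ℕP.m<n⇒0<n∸m t<c))) ⟩
    + k - + k - + 1               ≡⟨ cancel (+ k) ⟩
    - + 1                         ∎
    where
    v = c ∸ t
    cancel : ∀ (a : ℤ) → a - a - + 1 ≡ - + 1
    cancel = solve-∀
    shifted : + k - (+ t - + c) ≡ + (k ℕ.+ v)
    shifted = begin
      + k - (+ t - + c)   ≡⟨ cong (λ z → + k - z) (ℤP.m-n≡m⊖n t c) ⟩
      + k - (t ℤ.⊖ c)     ≡⟨ cong (λ z → + k - z) (ℤP.⊖-≤ (ℕP.<⇒≤ t<c)) ⟩
      + k - - + v         ≡⟨ cong (λ z → + k + z) (ℤP.neg-involutive (+ v)) ⟩
      + (k ℕ.+ v)         ∎

  -- F extended backwards by f^k_{k,-k} = -1 and zeros: Φ (c + s) = F s.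
  Φ : ℕ → ℤ
  Φ = pad d (- + 1) F

  Φ-window-at : ∀ s → Φ (c ℕ.+ s ∸ s) ≡ + 1
  Φ-window-at s = begin
    Φ (c ℕ.+ s ∸ s)  ≡⟨ cong Φ (trans (ℕP.m+n∸n≡m c s) (sym (ℕP.+-identityʳ c))) ⟩
    Φ (c ℕ.+ 0)      ≡⟨ pad-above d (- + 1) F 0 ⟩
    F 0              ≡⟨ F-start ⟩
    + 1              ∎

  Φ-window-next : ∀ s → Φ (c ℕ.+ s ∸ suc s) ≡ - + 1
  Φ-window-next s = trans (cong Φ (ℕP.m+n∸n≡m d s)) (pad-at d (- + 1) F)

  Φ-window-low : ∀ s i → 1 ≤ i → i < s → s ≤ k → Φ (c ℕ.+ s ∸ i) ≡ + 0
  Φ-window-low s i 1≤i i<s s≤k = begin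
    Φ (c ℕ.+ s ∸ i)    ≡⟨ cong Φ (ℕP.+-∸-assoc c (ℕP.<⇒≤ i<s)) ⟩
    Φ (c ℕ.+ (s ∸ i))  ≡⟨ pad-above d (- + 1) F (s ∸ i) ⟩
    F (s ∸ i)          ≡⟨ F-zero (s ∸ i) (ℕP.m<n⇒0<n∸m i<s)
                            (ℕP.<-≤-trans (ℕP.∸-monoʳ-< 1≤i (ℕP.<⇒≤ i<s)) s≤k) ⟩
    + 0                ∎

  Φ-window-high : ∀ s i → 1 ≤ s → suc (suc s) ≤ i → i ≤ k → Φ (c ℕ.+ s ∸ i) ≡ + 0
  Φ-window-high s i 1≤s s+2≤i i≤k = pad-below d (- + 1) F (c ℕ.+ s ∸ i)
    (ℕP.m<n+o⇒m∸n<o (c ℕ.+ s) i {{ℕ.>-nonZero 0<d}} below)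
    where
    0<d : 0 < d
    0<d = ℕP.≤-trans 1≤s (ℕP.≤-pred (ℕP.≤-pred (ℕP.≤-trans s+2≤i i≤k)))
    below : c ℕ.+ s < i ℕ.+ d
    below = subst₂ _<_ (ℕP.+-suc d s) (ℕP.+-comm d i) (ℕP.+-monoʳ-< d s+2≤i)

  -- Φ solves the recurrence: for c + s with s ≥ k this is the recurrence of F;
  -- for 1 ≤ s < k both sides vanish, the right one since Φ c + Φ d = 1 - 1.
  Φ-recurrent : Recurrent k Φ
  Φ-recurrent t k≤t = subst (λ m → Φ m ≡ Σ₁ k (λ i → Φ (m ∸ i)))
                            (ℕP.m+[n∸m]≡n (ℕP.≤-trans (ℕP.n≤1+n c) k≤t))
                            (at (t ∸ c) (ℕP.m<n⇒0<n∸m k≤t))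
    where
    at : ∀ s → 1 ≤ s → Φ (c ℕ.+ s) ≡ Σ₁ k (λ i → Φ (c ℕ.+ s ∸ i))
    at s 1≤s with s ℕ.<? k
    ... | yes s<k = begin
      Φ (c ℕ.+ s)  ≡⟨ pad-above d (- + 1) F s ⟩
      F s          ≡⟨ F-zero s 1≤s s<k ⟩
      + 1 + - + 1  ≡⟨ sym (cong₂ _+_ (Φ-window-at s) (Φ-window-next s)) ⟩
      Φ (c ℕ.+ s ∸ s) + Φ (c ℕ.+ s ∸ suc s)
                   ≡⟨ sym (Σ₁-two k s 1≤s s<k
                        (λ i 1≤i i<s → Φ-window-low s i 1≤i i<s (ℕP.<⇒≤ s<k))
                        (λ i s+1<i i≤k → Φ-window-high s i 1≤s s+1<i i≤k)) ⟩
      Σ₁ k (λ i → Φ (c ℕ.+ s ∸ i)) ∎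
    ... | no s≮k = begin
      Φ (c ℕ.+ s)                    ≡⟨ pad-above d (- + 1) F s ⟩
      F s                            ≡⟨ term-recurrent k (fibInit k) (s≤s z≤n) s k≤s ⟩
      Σ₁ k (λ i → F (s ∸ i))         ≡⟨ Σ₁-cong k (λ i _ i≤k → sym (begin
          Φ (c ℕ.+ s ∸ i)    ≡⟨ cong Φ (ℕP.+-∸-assoc c (ℕP.≤-trans i≤k k≤s)) ⟩
          Φ (c ℕ.+ (s ∸ i))  ≡⟨ pad-above d (- + 1) F (s ∸ i) ⟩
          F (s ∸ i)          ∎)) ⟩
      Σ₁ k (λ i → Φ (c ℕ.+ s ∸ i))   ∎
      where k≤s = ℕP.≮⇒≥ s≮k

  Ψ : ℕ → ℤ
  Ψ = shiftSum k +_ Φ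

  Ψ-window : ∀ t → Ψ t ≡ Σ₁ k (λ j → + j * Φ (c ℕ.+ suc t ∸ j))
  Ψ-window t = Σ₁-cong k (λ j _ _ → cong (λ m → + j * Φ (m ∸ j))
                                         (trans (ℕP.+-comm t k) (sym (ℕP.+-suc c t))))

  Ψ-below : ∀ t → t < c → Ψ t ≡ - + 1
  Ψ-below t t<c = begin
    Ψ t  ≡⟨ Ψ-window t ⟩
    Σ₁ k (λ j → + j * Φ (c ℕ.+ suc t ∸ j))
         ≡⟨ Σ₁-two k (suc t) (s≤s z≤n) (s≤s t<c)
              (λ j 1≤j j<t+1 → trans (cong (+ j *_)
                   (Φ-window-low (suc t) j 1≤j j<t+1 (ℕP.m≤n⇒m≤1+n t<c))) (ℤP.*-zeroʳ (+ j)))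
              (λ j t+2<j j≤k → trans (cong (+ j *_)
                   (Φ-window-high (suc t) j (s≤s z≤n) t+2<j j≤k)) (ℤP.*-zeroʳ (+ j))) ⟩
    + suc t * Φ (c ℕ.+ suc t ∸ suc t) + + suc (suc t) * Φ (c ℕ.+ suc t ∸ suc (suc t))
         ≡⟨ cong₂ (λ x y → + suc t * x + + suc (suc t) * y)
                  (Φ-window-at (suc t)) (Φ-window-next (suc t)) ⟩
    + suc t * + 1 + + suc (suc t) * - + 1
         ≡⟨ consecutive (+ t) ⟩
    - + 1 ∎
    where
    consecutive : ∀ (x : ℤ) → (+ 1 + x) * + 1 + (+ 1 + (+ 1 + x)) * (- + 1) ≡ - + 1
    consecutive = solve-∀

  Ψ-at : Ψ c ≡ + k
  Ψ-at = begin
    Ψ c                                ≡⟨ Ψ-window c ⟩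
    Σ₁ k (λ j → + j * Φ (c ℕ.+ k ∸ j))  ≡⟨ Σ₁-last c (λ j 1≤j j≤c → trans (cong (+ j *_)
                                             (Φ-window-low k j 1≤j (s≤s j≤c) ℕP.≤-refl)) (ℤP.*-zeroʳ (+ j))) ⟩
    + k * Φ (c ℕ.+ k ∸ k)               ≡⟨ cong (+ k *_) (Φ-window-at k) ⟩
    + k * + 1                           ≡⟨ ℤP.*-identityʳ (+ k) ⟩
    + k                                 ∎

  L≡Ψ : ∀ m → L m ≡ Ψ m
  L≡Ψ = recurrent-unique k
          (term-recurrent k (lucInit k k) (s≤s z≤n))
          (shiftSum-recurrent k k +_ Φ Φ-recurrent)
          window
    where
    window : ∀ m → m < k → L m ≡ Ψ m
    window m m<k with m ℕ.≟ c
    ... | yes refl = trans L-at (sym Ψ-at)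
    ... | no  m≢c  = trans (L-below m m<c) (sym (Ψ-below m m<c))
      where m<c = ℕP.≤∧≢⇒< (ℕP.≤-pred m<k) m≢c

  Φ-as-fib : ∀ n j → j ≤ k → Φ (n ℕ.+ c ℕ.+ k ∸ j) ≡ fib k k (+ n + + 1 - + j)
  Φ-as-fib n j j≤k = begin
    Φ (n ℕ.+ c ℕ.+ k ∸ j)       ≡⟨ cong Φ reindex ⟩
    Φ (c ℕ.+ (n ℕ.+ k ∸ j))     ≡⟨ pad-above d (- + 1) F (n ℕ.+ k ∸ j) ⟩
    F (n ℕ.+ k ∸ j)             ≡⟨ sym (recSeq-term k (fibInit k) (n ℕ.+ k ∸ j)) ⟩
    fib k k (+ (n ℕ.+ k ∸ j) - + c) ≡⟨ cong (fib k k) external ⟩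
    fib k k (+ n + + 1 - + j)   ∎
    where
    j≤n+k = ℕP.≤-trans j≤k (ℕP.m≤n+m k n)
    reindex : n ℕ.+ c ℕ.+ k ∸ j ≡ c ℕ.+ (n ℕ.+ k ∸ j)
    reindex = trans (cong (λ m → m ℕ.+ k ∸ j) (ℕP.+-comm n c))
                    (trans (cong (_∸ j) (ℕP.+-assoc c n k)) (ℕP.+-∸-assoc c j≤n+k))
    shuffle : ∀ (a x y : ℤ) → a + (+ 1 + y) - x - y ≡ a + + 1 - x
    shuffle = solve-∀
    external : + (n ℕ.+ k ∸ j) - + c ≡ + n + + 1 - + j
    external = begin
      + (n ℕ.+ k ∸ j) - + c    ≡⟨ cong (_- + c) (sym (trans (ℤP.m-n≡m⊖n (n ℕ.+ k) j) (ℤP.⊖-≥ j≤n+k))) ⟩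
      + (n ℕ.+ k) - + j - + c  ≡⟨ shuffle (+ n) (+ j) (+ c) ⟩
      + n + + 1 - + j          ∎

theorem2p8 : (k : ℕ) → k ≥ 2 → (n : ℕ) →
    luc k k (+ n) ≡ Σ₁ k (λ j → + j * fib k k (+ n + + 1 - + j))
theorem2p8 (suc (suc d)) (s≤s (s≤s _)) n = begin
  L (n ℕ.+ c)                                     ≡⟨ L≡Ψ (n ℕ.+ c) ⟩
  Σ₁ k (λ j → + j * Φ (n ℕ.+ c ℕ.+ k ∸ j))        ≡⟨ Σ₁-cong k (λ j _ j≤k → cong (+ j *_) (Φ-as-fib n j j≤k)) ⟩
  Σ₁ k (λ j → + j * fib k k (+ n + + 1 - + j))    ∎
  where open Order d
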